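{- Assume the following hypothesis: for every $\epsilon > 0$ there is $D_\epsilon$ such that every discriminant $D > D_\epsilon$ of a real quadratic field admits an odd prime $p$ with $\left(\frac{D}{p}\right) = 1$ and $\frac{1}{2}\sqrt{D} \leq p \leq \left(\frac{1}{2}+\epsilon\right)\sqrt{D}$. Then $$\limsup_{D \to \infty} \frac{H_{\min}(D)}{\sqrt{D}} \leq \frac{1}{2},$$ where $D$ runs through the discriminants of real quadratic fields.
   Context: For an algebraic number $\alpha$ with minimal polynomial $f = a_n x^n + \dots + a_0$ over $\mathbf{Q}$ normalized so that $a_i \in \mathbf{Z}$ and $\gcd(a_0,\dots,a_n)=1$, the height is $H(\alpha) = \max(|a_0|,\dots,|a_n|)$. For a quadratic field discriminant $D$, $H_{\min}(D)$ is the minimum of $H(\alpha)$ over all $\alpha$ with $\mathbf{Q}(\alpha) = \mathbf{Q}(\sqrt{D})$. $\left(\frac{D}{p}\right)$ is the Legendre symbol. -}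

module Defs where

open import Data.Nat as ℕ using (ℕ; zero; suc; NonZero)
open import Data.Nat.DivMod using (_%_)
open import Data.Nat.Divisibility using (_∣_)
open import Data.Nat.GCD using (gcd)
open import Data.Nat.Primality using (Prime)
open import Data.Integer as ℤ using (ℤ; +_; ∣_∣)
open import Data.Rational as ℚ using (ℚ; _/_)
open import Data.List using (List; upTo)
open import Data.Bool.ListAction using (any)
open import Data.Bool using (Bool; true; false; if_then_else_)
open import Data.Product using (Σ; ∃; _×_; _,_)
open import Data.Sum using (_⊎_)
open import Relation.Nullary using (¬_)
open import Relation.Nullary.Decidable using (⌊_⌋)
open import Relation.Binary.PropositionalEquality using (_≡_; _≢_)

SquareFree : ℕ → Set
SquareFree m = ∀ n → (n ℕ.* n) ∣ m → n ≡ 1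

RealQuadDisc : ℕ → Set
RealQuadDisc D =
  1 ℕ.< D ×
  ((D % 4 ≡ 1 × SquareFree D) ⊎
   (Σ ℕ λ m → D ≡ 4 ℕ.* m × (m % 4 ≡ 2 ⊎ m % 4 ≡ 3) × SquareFree m))

-- Legendre symbol (D / p) for p an odd prime (junk value 0 at p = 0):
-- 0 if p ∣ D, 1 if D is a nonzero square mod p, -1 otherwise.
legendre : ℕ → ℕ → ℤ
legendre D zero = + 0
legendre D (suc k) =
  if ⌊ D % suc k ℕ.≟ 0 ⌋ then + 0
  else (if any (λ x → ⌊ (x ℕ.* x) % suc k ℕ.≟ D % suc k ⌋) (upTo (suc k))
        then + 1 else ℤ.- (+ 1))

height : ℤ → ℤ → ℤ → ℕ
height a b c = ∣ a ∣ ℕ.⊔ ∣ b ∣ ℕ.⊔ ∣ c ∣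

-- (a, b, c) is a normalized minimal polynomial (integer coefficients,
-- gcd = 1) over ℚ of some α with ℚ(α) = ℚ(√D).
-- Such α are exactly α = r + s√D with r, s ∈ ℚ, s ≠ 0; its minimal
-- polynomial is x² - 2r x + (r² - s² D), so the normalized integer
-- minimal polynomials are the primitive integer multiples a·(that).
IsMinPolyOfGenerator : ℕ → ℤ → ℤ → ℤ → Set
IsMinPolyOfGenerator D a b c =
  Σ ℚ λ r → Σ ℚ λ s →
    s ≢ ℚ.0ℚ ×
    a ≢ + 0 ×
    gcd (gcd ∣ a ∣ ∣ b ∣) ∣ c ∣ ≡ 1 ×
    (b / 1) ≡ ℚ.- ((+ 2 / 1) ℚ.* r ℚ.* (a / 1)) ×
    (c / 1) ≡ (a / 1) ℚ.* (r ℚ.* r ℚ.- s ℚ.* s ℚ.* (+ D / 1))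

IsHmin : ℕ → ℕ → Set
IsHmin D h =
  (Σ ℤ λ a → Σ ℤ λ b → Σ ℤ λ c → IsMinPolyOfGenerator D a b c × height a b c ≡ h) ×
  (∀ a b c → IsMinPolyOfGenerator D a b c → h ℕ.≤ height a b c)

ℕtoℚ : ℕ → ℚ
ℕtoℚ n = + n / 1

{-# OPTIONS --safe #-}
module Submission where

-- Let p be the odd prime given by the hypothesis: (D/p) = 1 and D ≤ 4p² ≤ (1 + 2ε)² D.
-- A square root x of D mod p, replaced by p - x when needed to match the parity of D, is a
-- b ∈ [0, p] with b² ≡ D (mod 4p), because D ≡ 0, 1 (mod 4). Then c = (b² - D)/4p has
-- |c| ≤ p as |b² - D| ≤ 4p², and p ∤ b as p ∤ D, so p x² + b x + c is a primitive
-- polynomial of discriminant D, the minimal polynomial of (-b + √D)/2p. Its height is p,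
-- whence H_min(D)² ≤ p² ≤ (½ + ε)² D.

open import Defs
open import Level using (0ℓ)
open import Data.Bool using (true; false; T)
open import Data.Bool.ListAction using (any)
open import Data.List using (upTo)
open import Data.List.Membership.Propositional using (find)
open import Data.List.Membership.Propositional.Properties using (∈-upTo⁻)
open import Data.List.Relation.Unary.Any.Properties using (any⁻)
open import Data.Nat as ℕ using (ℕ; suc; NonZero; _∸_; s≤s)
open import Data.Nat.Properties as ℕ using ()
open import Data.Nat.DivMod as ℕ using (_%_)
open import Data.Nat.Divisibility as ℕ using ()
open import Data.Nat.Coprimality as ℕ using (Coprime)
open import Data.Nat.GCD using (gcd; gcd-zeroˡ)
open import Data.Nat.Primality
  using (Prime; prime⇒irreducible; prime⇒nonZero; prime[2]; ¬prime[0]; ¬prime[1]; euclidsLemma)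
open import Data.Integer as ℤ using (ℤ; +_; ∣_∣; _⊖_)
open import Data.Integer.Properties as ℤ using ()
open import Data.Integer.Coprimality as ℤ using (coprime-divisor)
open import Data.Integer.Divisibility.Signed as ℤ using (_∣_; divides)
import Data.Integer.Tactic.RingSolver as ℤ
open import Data.Rational as ℚ using (ℚ; ½; mkℚ; 0ℚ; 1ℚ)
open import Data.Rational.Properties as ℚ using ()
import Data.Rational.Unnormalised as ℚᵘ
import Data.Rational.Unnormalised.Properties as ℚᵘ
open import Data.Product using (Σ; ∃-syntax; _×_; _,_; proj₁; proj₂)
open import Data.Sum using (_⊎_; inj₁; inj₂; [_,_]′)
open import Data.Unit using (tt)
open import Relation.Nullary using (¬_; yes; no; contradiction)
open import Relation.Nullary.Decidable using (⌊_⌋; toWitness; dec⇒maybe)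
open import Relation.Binary.PropositionalEquality
open import Tactic.RingSolver using (solve-∀)
open import Tactic.RingSolver.Core.AlmostCommutativeRing
  using (AlmostCommutativeRing; fromCommutativeRing)

pos-∸ : ∀ {m n} → n ℕ.≤ m → + (m ∸ n) ≡ + m ℤ.- + n
pos-∸ {m} {n} n≤m = trans (sym (ℤ.⊖-≥ n≤m)) (sym (ℤ.m-n≡m⊖n m n))

pos-divMod : ∀ m n .{{_ : NonZero n}} → + m ≡ + (m % n) ℤ.+ + (m ℕ./ n) ℤ.* + n
pos-divMod m n = begin
  + m                                   ≡⟨ cong +_ (ℕ.m≡m%n+[m/n]*n m n) ⟩
  + (m % n ℕ.+ m ℕ./ n ℕ.* n)           ≡⟨ ℤ.pos-+ (m % n) (m ℕ./ n ℕ.* n) ⟩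
  + (m % n) ℤ.+ + (m ℕ./ n ℕ.* n)       ≡⟨ cong (ℤ._+_ (+ (m % n))) (ℤ.pos-* (m ℕ./ n) n) ⟩
  + (m % n) ℤ.+ + (m ℕ./ n) ℤ.* + n     ∎
  where open ≡-Reasoning

m-[m-n]≡n : ∀ m n → m ℤ.- (m ℤ.- n) ≡ n
m-[m-n]≡n = ℤ.solve-∀

m%n≡k%n⇒n∣m-k : ∀ m k n .{{_ : NonZero n}} → m % n ≡ k % n → + n ∣ + m ℤ.- + k
m%n≡k%n⇒n∣m-k m k n eq = divides (+ (m ℕ./ n) ℤ.- + (k ℕ./ n)) (begin
  + m ℤ.- + k
    ≡⟨ cong₂ ℤ._-_ (pos-divMod m n) (pos-divMod k n) ⟩
  (+ (m % n) ℤ.+ + (m ℕ./ n) ℤ.* + n) ℤ.- (+ (k % n) ℤ.+ + (k ℕ./ n) ℤ.* + n)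
    ≡⟨ cong (λ r → (+ r ℤ.+ + (m ℕ./ n) ℤ.* + n) ℤ.- (+ (k % n) ℤ.+ + (k ℕ./ n) ℤ.* + n)) eq ⟩
  (+ (k % n) ℤ.+ + (m ℕ./ n) ℤ.* + n) ℤ.- (+ (k % n) ℤ.+ + (k ℕ./ n) ℤ.* + n)
    ≡⟨ cancel (+ (k % n)) (+ (m ℕ./ n)) (+ (k ℕ./ n)) (+ n) ⟩
  (+ (m ℕ./ n) ℤ.- + (k ℕ./ n)) ℤ.* + n ∎)
  where
  open ≡-Reasoning
  cancel : ∀ r q q′ n → (r ℤ.+ q ℤ.* n) ℤ.- (r ℤ.+ q′ ℤ.* n) ≡ (q ℤ.- q′) ℤ.* n
  cancel = ℤ.solve-∀

coprime⇒∣∧∣⇒*∣ : ∀ {i j m} → Coprime ∣ i ∣ ∣ j ∣ → i ∣ m → j ∣ m → i ℤ.* j ∣ m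
coprime⇒∣∧∣⇒*∣ {i} {j} coprime i∣qj (divides q refl) = ℤ.*-monoˡ-∣ j i∣q
  where
  i∣q : i ∣ q
  i∣q = ℤ.∣ᵤ⇒∣ (coprime-divisor i j q coprime (ℤ.∣⇒∣ᵤ (subst (i ∣_) (ℤ.*-comm q j) i∣qj)))

prime∤⇒coprime : ∀ {p n} → Prime p → ¬ p ℕ.∣ n → Coprime p n
prime∤⇒coprime p-prime p∤n (d∣p , d∣n) with prime⇒irreducible p-prime d∣p
... | inj₁ d≡1 = d≡1
... | inj₂ refl = contradiction d∣n p∤n

prime≢2⇒odd : ∀ {p} → Prime p → p ≢ 2 → p % 2 ≡ 1
prime≢2⇒odd {p} p-prime p≢2 with p % 2 in eq | ℕ.m%n<n p 2
... | 0 | _ with prime⇒irreducible p-prime (ℕ.m%n≡0⇒n∣m p 2 eq)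
...   | inj₂ 2≡p = contradiction (sym 2≡p) p≢2
prime≢2⇒odd _ _ | 1 | _ = refl
prime≢2⇒odd _ _ | suc (suc _) | s≤s (s≤s ())

prime≢2⇒coprime[4] : ∀ {p} → Prime p → p ≢ 2 → Coprime 4 p
prime≢2⇒coprime[4] {p} p-prime p≢2 = ℕ.sym (prime∤⇒coprime p-prime p∤4)
  where
  p∤2 : ¬ p ℕ.∣ 2
  p∤2 p∣2 = [ (λ p≡1 → ¬prime[1] (subst Prime p≡1 p-prime)) , p≢2 ]′ (prime⇒irreducible prime[2] p∣2)
  p∤4 : ¬ p ℕ.∣ 4
  p∤4 p∣4 = [ p∤2 , p∤2 ]′ (euclidsLemma 2 2 p-prime p∣4)

infix 4 _²≡_mod_
_²≡_mod_ : ℕ → ℕ → ℕ → Set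
x ²≡ d mod n = + n ∣ + x ℤ.* + x ℤ.- + d

legendre≡1⇒sqrt : ∀ d p → legendre d p ≡ + 1 → ¬ p ℕ.∣ d × ∃[ x ] x ℕ.< p × x ²≡ d mod p
legendre≡1⇒sqrt d (suc k) eq with d % suc k ℕ.≟ 0
... | yes _ = contradiction eq λ ()
... | no d%p≢0 with any (λ x → ⌊ (x ℕ.* x) % suc k ℕ.≟ d % suc k ⌋) (upTo (suc k)) in found
...   | false = contradiction eq λ ()
...   | true =
  let x , x∈ , x²%p≡d%p = find (any⁻ _ (upTo (suc k)) (subst T (sym found) tt))
  in (λ p∣d → d%p≢0 (ℕ.n∣m⇒m%n≡0 d (suc k) p∣d)) ,
     x , ∈-upTo⁻ x∈ ,
     subst (λ x² → + suc k ∣ x² ℤ.- + d) (ℤ.pos-* x x) (m%n≡k%n⇒n∣m-k (x ℕ.* x) d (suc k) (toWitness x²%p≡d%p))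

²≡-reflect : ∀ {x d p} → x ℕ.≤ p → x ²≡ d mod p → (p ∸ x) ²≡ d mod p
²≡-reflect {x} {d} {p} x≤p x²≡d =
  subst (λ b → + p ∣ b ℤ.* b ℤ.- + d) (sym (pos-∸ x≤p))
    (subst (+ p ∣_) (sym (reflect (+ p) (+ x) (+ d)))
      (ℤ.∣m∣n⇒∣m+n x²≡d (ℤ.∣n⇒∣m*n (+ p ℤ.- + 2 ℤ.* + x) ℤ.∣-refl)))
  where
  reflect : ∀ p x d → (p ℤ.- x) ℤ.* (p ℤ.- x) ℤ.- d ≡ (x ℤ.* x ℤ.- d) ℤ.+ (p ℤ.- + 2 ℤ.* x) ℤ.* p
  reflect = ℤ.solve-∀

²≡-coprime-* : ∀ {x d m n} → Coprime m n → x ²≡ d mod m → x ²≡ d mod n → x ²≡ d mod (m ℕ.* n)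
²≡-coprime-* {m = m} {n} coprime x²≡d[m] x²≡d[n] =
  subst (_∣ _) (sym (ℤ.pos-* m n)) (coprime⇒∣∧∣⇒*∣ coprime x²≡d[m] x²≡d[n])

realQuadDisc⇒4∣d[d-1] : ∀ {d} → RealQuadDisc d → + 4 ∣ + d ℤ.* (+ d ℤ.- + 1)
realQuadDisc⇒4∣d[d-1] {d} (_ , inj₁ (d%4≡1 , _)) = ℤ.∣n⇒∣m*n (+ d) (m%n≡k%n⇒n∣m-k d 1 4 d%4≡1)
realQuadDisc⇒4∣d[d-1] (_ , inj₂ (m , refl , _)) =
  ℤ.∣m⇒∣m*n _ (divides (+ m) (trans (ℤ.pos-* 4 m) (ℤ.*-comm (+ 4) (+ m))))

²≡-mod-4 : ∀ {x d} → + 4 ∣ + d ℤ.* (+ d ℤ.- + 1) → + 2 ∣ + x ℤ.+ + d → x ²≡ d mod 4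
²≡-mod-4 {x} {d} 4∣d[d-1] 2∣x+d =
  subst (+ 4 ∣_) (sym (complete-square (+ x) (+ d)))
    (ℤ.∣m∣n⇒∣m+n (ℤ.∣m∣n⇒∣m-n 4∣[x+d]² (ℤ.∣n⇒∣m*n (+ d) 4∣2[x+d])) 4∣d[d-1])
  where
  complete-square : ∀ x d →
    x ℤ.* x ℤ.- d ≡ (x ℤ.+ d) ℤ.* (x ℤ.+ d) ℤ.- d ℤ.* (+ 2 ℤ.* (x ℤ.+ d)) ℤ.+ d ℤ.* (d ℤ.- + 1)
  complete-square = ℤ.solve-∀
  4∣2[x+d] : + 4 ∣ + 2 ℤ.* (+ x ℤ.+ + d)
  4∣2[x+d] = ℤ.*-monoʳ-∣ (+ 2) 2∣x+d
  4∣[x+d]² : + 4 ∣ (+ x ℤ.+ + d) ℤ.* (+ x ℤ.+ + d)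
  4∣[x+d]² = ℤ.∣-trans 4∣2[x+d] (ℤ.*-monoˡ-∣ (+ x ℤ.+ + d) 2∣x+d)

parity-choice : ∀ {p} x d → p % 2 ≡ 1 → x ℕ.≤ p → + 2 ∣ + x ℤ.+ + d ⊎ + 2 ∣ + (p ∸ x) ℤ.+ + d
parity-choice {p} x d p%2≡1 x≤p with (x ℕ.+ d) % 2 in eq | ℕ.m%n<n (x ℕ.+ d) 2
... | 0 | _ = inj₁ (subst (+ 2 ∣_) (ℤ.pos-+ x d) (ℤ.∣ᵤ⇒∣ (ℕ.m%n≡0⇒n∣m (x ℕ.+ d) 2 eq)))
... | suc (suc _) | s≤s (s≤s ())
... | 1 | _ = inj₂ (subst (+ 2 ∣_) (sym p∸x+d≡)
  (ℤ.∣m∣n⇒∣m+n (m%n≡k%n⇒n∣m-k p (x ℕ.+ d) 2 (trans p%2≡1 (sym eq))) (ℤ.∣n⇒∣m*n (+ d) ℤ.∣-refl)))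
  where
  regroup : ∀ p x d → p ℤ.- x ℤ.+ d ≡ p ℤ.- (x ℤ.+ d) ℤ.+ d ℤ.* + 2
  regroup = ℤ.solve-∀
  p∸x+d≡ : + (p ∸ x) ℤ.+ + d ≡ + p ℤ.- + (x ℕ.+ d) ℤ.+ + d ℤ.* + 2
  p∸x+d≡ = begin
    + (p ∸ x) ℤ.+ + d                     ≡⟨ cong (ℤ._+ + d) (pos-∸ x≤p) ⟩
    + p ℤ.- + x ℤ.+ + d                   ≡⟨ regroup (+ p) (+ x) (+ d) ⟩
    + p ℤ.- (+ x ℤ.+ + d) ℤ.+ + d ℤ.* + 2 ≡⟨ cong (λ x+d → + p ℤ.- x+d ℤ.+ + d ℤ.* + 2) (ℤ.pos-+ x d) ⟨
    + p ℤ.- + (x ℕ.+ d) ℤ.+ + d ℤ.* + 2   ∎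
    where open ≡-Reasoning

sqrt-mod-4p : ∀ {d p x} → Prime p → p ≢ 2 → + 4 ∣ + d ℤ.* (+ d ℤ.- + 1) →
              x ℕ.< p → x ²≡ d mod p → ∃[ b ] b ℕ.≤ p × b ²≡ d mod (4 ℕ.* p)
sqrt-mod-4p {d} {p} {x} p-prime p≢2 4∣d[d-1] x<p x²≡d
  with parity-choice x d (prime≢2⇒odd p-prime p≢2) (ℕ.<⇒≤ x<p)
... | inj₁ 2∣x+d = x , ℕ.<⇒≤ x<p ,
  ²≡-coprime-* {x} (prime≢2⇒coprime[4] p-prime p≢2) (²≡-mod-4 {x} 4∣d[d-1] 2∣x+d) x²≡d
... | inj₂ 2∣x′+d = p ∸ x , ℕ.m∸n≤m p x ,
  ²≡-coprime-* {p ∸ x} (prime≢2⇒coprime[4] p-prime p≢2) (²≡-mod-4 {p ∸ x} 4∣d[d-1] 2∣x′+d)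
    (²≡-reflect {x} (ℕ.<⇒≤ x<p) x²≡d)

discriminant : ℤ → ℤ → ℤ → ℤ
discriminant a b c = b ℤ.* b ℤ.- + 4 ℤ.* a ℤ.* c

sqrt⇒coprime : ∀ {b d p} → Prime p → ¬ p ℕ.∣ d → b ²≡ d mod p → Coprime p b
sqrt⇒coprime {b} {d} {p} p-prime p∤d b²≡d = prime∤⇒coprime p-prime p∤b
  where
  p∤b : ¬ p ℕ.∣ b
  p∤b p∣b = p∤d (ℤ.∣⇒∣ᵤ (subst (+ p ∣_) (m-[m-n]≡n (+ b ℤ.* + b) (+ d))
    (ℤ.∣m∣n⇒∣m-n (ℤ.∣m⇒∣m*n {m = + b} (+ b) (ℤ.∣ᵤ⇒∣ p∣b)) b²≡d)))

form-of-sqrt : ∀ {b d p} → Prime p → ¬ p ℕ.∣ d → d ℕ.≤ 4 ℕ.* (p ℕ.* p) →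
               b ℕ.≤ p → b ²≡ d mod (4 ℕ.* p) →
               ∃[ c ] discriminant (+ p) (+ b) c ≡ + d × gcd (gcd p b) ∣ c ∣ ≡ 1 × height (+ p) (+ b) c ℕ.≤ p
form-of-sqrt {b} {d} {p} p-prime p∤d d≤4p² b≤p b²≡d@(divides c b²-d≡c*4p) =
  c , disc≡d , gcd≡1 , ℕ.⊔-lub (ℕ.⊔-lub ℕ.≤-refl b≤p) ∣c∣≤p
  where
  instance
    p≢0 : NonZero p
    p≢0 = prime⇒nonZero p-prime
    4p≢0 : NonZero (4 ℕ.* p)
    4p≢0 = ℕ.m*n≢0 4 p
  disc≡d : discriminant (+ p) (+ b) c ≡ + d
  disc≡d = begin
    + b ℤ.* + b ℤ.- + 4 ℤ.* + p ℤ.* c    ≡⟨ cong (ℤ._-_ (+ b ℤ.* + b)) 4pc≡c*4p ⟩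
    + b ℤ.* + b ℤ.- c ℤ.* + (4 ℕ.* p)    ≡⟨ cong (ℤ._-_ (+ b ℤ.* + b)) b²-d≡c*4p ⟨
    + b ℤ.* + b ℤ.- (+ b ℤ.* + b ℤ.- + d) ≡⟨ m-[m-n]≡n (+ b ℤ.* + b) (+ d) ⟩
    + d                                    ∎
    where
    open ≡-Reasoning
    4pc≡c*4p : + 4 ℤ.* + p ℤ.* c ≡ c ℤ.* + (4 ℕ.* p)
    4pc≡c*4p = trans (cong (ℤ._* c) (sym (ℤ.pos-* 4 p))) (ℤ.*-comm (+ (4 ℕ.* p)) c)
  gcd≡1 : gcd (gcd p b) ∣ c ∣ ≡ 1
  gcd≡1 = trans (cong (λ g → gcd g ∣ c ∣) (ℕ.coprime⇒gcd≡1 p⊥b)) (gcd-zeroˡ ∣ c ∣)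
    where
    p⊥b : Coprime p b
    p⊥b = sqrt⇒coprime {b} p-prime p∤d (ℤ.∣-trans (divides (+ 4) (ℤ.pos-* 4 p)) b²≡d)
  ∣c∣≤p : ∣ c ∣ ℕ.≤ p
  ∣c∣≤p = ℕ.*-cancelʳ-≤ ∣ c ∣ p (4 ℕ.* p) (begin
    ∣ c ∣ ℕ.* (4 ℕ.* p)            ≡⟨ ℤ.abs-* c (+ (4 ℕ.* p)) ⟨
    ∣ c ℤ.* + (4 ℕ.* p) ∣          ≡⟨ cong ∣_∣ b²-d≡c*4p ⟨
    ∣ + b ℤ.* + b ℤ.- + d ∣        ≡⟨ cong (λ b² → ∣ b² ℤ.- + d ∣) (ℤ.pos-* b b) ⟨
    ∣ + (b ℕ.* b) ℤ.- + d ∣        ≡⟨ cong ∣_∣ (ℤ.m-n≡m⊖n (b ℕ.* b) d) ⟩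
    ∣ b ℕ.* b ⊖ d ∣                ≤⟨ ℤ.∣m⊝n∣≤m⊔n (b ℕ.* b) d ⟩
    b ℕ.* b ℕ.⊔ d                  ≤⟨ ℕ.⊔-lub b²≤4p² d≤4p² ⟩
    4 ℕ.* (p ℕ.* p)                ≡⟨ regroup p ⟩
    p ℕ.* (4 ℕ.* p)                ∎)
    where
    open ℕ.≤-Reasoning
    b²≤4p² : b ℕ.* b ℕ.≤ 4 ℕ.* (p ℕ.* p)
    b²≤4p² = ℕ.≤-trans (ℕ.*-mono-≤ b≤p b≤p) (ℕ.m≤m+n (p ℕ.* p) (3 ℕ.* (p ℕ.* p)))
    regroup : ∀ p → 4 ℕ.* (p ℕ.* p) ≡ p ℕ.* (4 ℕ.* p)
    regroup p = trans (sym (ℕ.*-assoc 4 p p)) (ℕ.*-comm (4 ℕ.* p) p)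

-- Unlike i / 1, this is definitionally a fraction with denominator 1, so toℚᵘ computes on it.
fromℤ : ℤ → ℚ
fromℤ i = mkℚ i 0 (ℕ.sym (ℕ.1-coprimeTo ∣ i ∣))

/1≡fromℤ : ∀ i → i ℚ./ 1 ≡ fromℤ i
/1≡fromℤ i = ℚ.↥p/↧p≡p (fromℤ i)

fromℤ-+ : ∀ i j → fromℤ (i ℤ.+ j) ≡ fromℤ i ℚ.+ fromℤ j
fromℤ-+ i j = ℚ.toℚᵘ-injective
  (ℚᵘ.≃-trans (ℚᵘ.*≡* (cross i j)) (ℚᵘ.≃-sym (ℚ.toℚᵘ-homo-+ (fromℤ i) (fromℤ j))))
  where
  cross : ∀ i j → (i ℤ.+ j) ℤ.* + 1 ≡ (i ℤ.* + 1 ℤ.+ j ℤ.* + 1) ℤ.* + 1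
  cross = ℤ.solve-∀

fromℤ-neg : ∀ i → fromℤ (ℤ.- i) ≡ ℚ.- fromℤ i
fromℤ-neg i = ℚ.toℚᵘ-injective (ℚᵘ.≃-trans (ℚᵘ.*≡* refl) (ℚᵘ.≃-sym (ℚ.toℚᵘ-homo‿- (fromℤ i))))

fromℤ-- : ∀ i j → fromℤ (i ℤ.- j) ≡ fromℤ i ℚ.- fromℤ j
fromℤ-- i j = trans (fromℤ-+ i (ℤ.- j)) (cong (fromℤ i ℚ.+_) (fromℤ-neg j))

fromℤ-* : ∀ i j → fromℤ (i ℤ.* j) ≡ fromℤ i ℚ.* fromℤ j
fromℤ-* i j = ℚ.toℚᵘ-injective (ℚᵘ.≃-trans (ℚᵘ.*≡* refl) (ℚᵘ.≃-sym (ℚ.toℚᵘ-homo-* (fromℤ i) (fromℤ j))))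

fromℤ-mono-≤ : ∀ {i j} → i ℤ.≤ j → fromℤ i ℚ.≤ fromℤ j
fromℤ-mono-≤ i≤j = ℚ.*≤* (ℤ.*-monoʳ-≤-nonNeg (+ 1) i≤j)

ℕtoℚ-mono-≤ : ∀ {m n} → m ℕ.≤ n → ℕtoℚ m ℚ.≤ ℕtoℚ n
ℕtoℚ-mono-≤ {m} {n} m≤n =
  subst₂ ℚ._≤_ (sym (/1≡fromℤ (+ m))) (sym (/1≡fromℤ (+ n))) (fromℤ-mono-≤ (ℤ.+≤+ m≤n))

-- The solver only cancels terms given a genuine zero test.
ℚ-ring : AlmostCommutativeRing 0ℓ 0ℓ
ℚ-ring = fromCommutativeRing ℚ.+-*-commutativeRing (λ q → dec⇒maybe (0ℚ ℚ.≟ q))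

-- Vieta's formulas for the roots r ± t √(b² - 4ac) of a x² + b x + c, where r = -b t and 2 a t = 1.
roots-of-quadratic : ∀ two a b c t → two ℚ.* a ℚ.* t ≡ 1ℚ →
  b ≡ ℚ.- (two ℚ.* ℚ.- (b ℚ.* t) ℚ.* a) ×
  c ≡ a ℚ.* (ℚ.- (b ℚ.* t) ℚ.* ℚ.- (b ℚ.* t) ℚ.- t ℚ.* t ℚ.* (b ℚ.* b ℚ.- two ℚ.* two ℚ.* a ℚ.* c))
roots-of-quadratic two a b c t 2at≡1 =
  (begin
    b                                ≡⟨ ℚ.*-identityʳ b ⟨
    b ℚ.* 1ℚ                         ≡⟨ cong (b ℚ.*_) 2at≡1 ⟨
    b ℚ.* (two ℚ.* a ℚ.* t)          ≡⟨ linear two a b t ⟩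
    ℚ.- (two ℚ.* ℚ.- (b ℚ.* t) ℚ.* a) ∎) ,
  (begin
    c                                                  ≡⟨ ℚ.*-identityˡ c ⟨
    1ℚ ℚ.* 1ℚ ℚ.* c                                    ≡⟨ cong (λ u → u ℚ.* u ℚ.* c) 2at≡1 ⟨
    (two ℚ.* a ℚ.* t) ℚ.* (two ℚ.* a ℚ.* t) ℚ.* c      ≡⟨ constant two a b c t ⟩
    a ℚ.* (ℚ.- (b ℚ.* t) ℚ.* ℚ.- (b ℚ.* t) ℚ.- t ℚ.* t ℚ.* (b ℚ.* b ℚ.- two ℚ.* two ℚ.* a ℚ.* c)) ∎)
  where
  open ≡-Reasoning
  linear : ∀ two a b t → b ℚ.* (two ℚ.* a ℚ.* t) ≡ ℚ.- (two ℚ.* ℚ.- (b ℚ.* t) ℚ.* a)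
  linear = solve-∀ ℚ-ring
  constant : ∀ two a b c t →
    (two ℚ.* a ℚ.* t) ℚ.* (two ℚ.* a ℚ.* t) ℚ.* c ≡
    a ℚ.* (ℚ.- (b ℚ.* t) ℚ.* ℚ.- (b ℚ.* t) ℚ.- t ℚ.* t ℚ.* (b ℚ.* b ℚ.- two ℚ.* two ℚ.* a ℚ.* c))
  constant = solve-∀ ℚ-ring

discriminant⇒isMinPolyOfGenerator : ∀ D a b c → a ≢ + 0 → gcd (gcd ∣ a ∣ ∣ b ∣) ∣ c ∣ ≡ 1 →
                                   discriminant a b c ≡ + D → IsMinPolyOfGenerator D a b c
discriminant⇒isMinPolyOfGenerator D a b c a≢0 gcd≡1 disc≡D =
  r , t , t≢0 , a≢0 , gcd≡1 , linear , constant
  where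
  instance
    a≢0′ : ℤ.NonZero a
    a≢0′ = ℤ.≢-nonZero a≢0
    2a≢0 : ℤ.NonZero (+ 2 ℤ.* a)
    2a≢0 = ℤ.i*j≢0 (+ 2) a
  t r : ℚ
  t = ℚ.1/ fromℤ (+ 2 ℤ.* a)
  r = ℚ.- (fromℤ b ℚ.* t)
  2at≡1 : fromℤ (+ 2) ℚ.* fromℤ a ℚ.* t ≡ 1ℚ
  2at≡1 = trans (cong (ℚ._* t) (sym (fromℤ-* (+ 2) a))) (ℚ.*-inverseʳ (fromℤ (+ 2 ℤ.* a)))
  t≢0 : t ≢ 0ℚ
  t≢0 t≡0 with trans (sym 2at≡1)
                (trans (cong (fromℤ (+ 2) ℚ.* fromℤ a ℚ.*_) t≡0) (ℚ.*-zeroʳ (fromℤ (+ 2) ℚ.* fromℤ a)))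
  ... | ()
  disc≡D-ℚ : fromℤ b ℚ.* fromℤ b ℚ.- fromℤ (+ 2) ℚ.* fromℤ (+ 2) ℚ.* fromℤ a ℚ.* fromℤ c ≡ fromℤ (+ D)
  disc≡D-ℚ = begin
    fromℤ b ℚ.* fromℤ b ℚ.- fromℤ (+ 2) ℚ.* fromℤ (+ 2) ℚ.* fromℤ a ℚ.* fromℤ c
      ≡⟨ cong₂ ℚ._-_ (fromℤ-* b b) (trans (fromℤ-* (+ 4 ℤ.* a) c) (cong (ℚ._* fromℤ c) (fromℤ-* (+ 4) a))) ⟨
    fromℤ (b ℤ.* b) ℚ.- fromℤ (+ 4 ℤ.* a ℤ.* c)        ≡⟨ fromℤ-- (b ℤ.* b) (+ 4 ℤ.* a ℤ.* c) ⟨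
    fromℤ (discriminant a b c)                          ≡⟨ cong fromℤ disc≡D ⟩
    fromℤ (+ D)                                         ∎
    where open ≡-Reasoning
  linear : b ℚ./ 1 ≡ ℚ.- ((+ 2 ℚ./ 1) ℚ.* r ℚ.* (a ℚ./ 1))
  linear = subst₂ (λ b′ a′ → b′ ≡ ℚ.- (fromℤ (+ 2) ℚ.* r ℚ.* a′)) (sym (/1≡fromℤ b)) (sym (/1≡fromℤ a))
    (proj₁ (roots-of-quadratic (fromℤ (+ 2)) (fromℤ a) (fromℤ b) (fromℤ c) t 2at≡1))
  constant : c ℚ./ 1 ≡ (a ℚ./ 1) ℚ.* (r ℚ.* r ℚ.- t ℚ.* t ℚ.* (+ D ℚ./ 1))
  constant rewrite /1≡fromℤ a | /1≡fromℤ c | /1≡fromℤ (+ D) | sym disc≡D-ℚ =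
    proj₂ (roots-of-quadratic (fromℤ (+ 2)) (fromℤ a) (fromℤ b) (fromℤ c) t 2at≡1)

Hmin≤p : ∀ {D p h} → RealQuadDisc D → Prime p → p ≢ 2 → legendre D p ≡ + 1 →
         D ℕ.≤ 4 ℕ.* (p ℕ.* p) → IsHmin D h → h ℕ.≤ p
Hmin≤p {D} {p} disc p-prime p≢2 [D/p]≡1 D≤4p² (_ , minimal) =
  let p∤D , x , x<p , x²≡D = legendre≡1⇒sqrt D p [D/p]≡1
      b , b≤p , b²≡D = sqrt-mod-4p {x = x} p-prime p≢2 (realQuadDisc⇒4∣d[d-1] disc) x<p x²≡D
      c , disc≡D , gcd≡1 , height≤p = form-of-sqrt {b} p-prime p∤D D≤4p² b≤p b²≡D
      isMinPoly = discriminant⇒isMinPolyOfGenerator D (+ p) (+ b) c p≢0 gcd≡1 disc≡D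
  in ℕ.≤-trans (minimal (+ p) (+ b) c isMinPoly) height≤p
  where
  p≢0 : + p ≢ + 0
  p≢0 p≡0 = ¬prime[0] (subst Prime (ℤ.+-injective p≡0) p-prime)

corollary1 :
    (∀ (ε : ℚ) → ℚ.0ℚ ℚ.< ε →
      Σ ℕ λ Dε → ∀ (D : ℕ) → RealQuadDisc D → Dε ℕ.< D →
        Σ ℕ λ p → Prime p × ¬ (p ≡ 2) × legendre D p ≡ + 1 ×
          (D ℕ.≤ 4 ℕ.* (p ℕ.* p)) ×
          (ℕtoℚ (p ℕ.* p) ℚ.≤ (½ ℚ.+ ε) ℚ.* (½ ℚ.+ ε) ℚ.* ℕtoℚ D)) →
    ∀ (ε : ℚ) → ℚ.0ℚ ℚ.< ε →
      Σ ℕ λ D₀ → ∀ (D : ℕ) → RealQuadDisc D → D₀ ℕ.< D →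
        ∀ (h : ℕ) → IsHmin D h →
          ℕtoℚ (h ℕ.* h) ℚ.≤ (½ ℚ.+ ε) ℚ.* (½ ℚ.+ ε) ℚ.* ℕtoℚ D
corollary1 hypothesis ε ε>0 =
  let Dε , prime-in-range = hypothesis ε ε>0
  in Dε , λ D disc Dε<D h hmin →
    let p , p-prime , p≢2 , [D/p]≡1 , D≤4p² , p²≤[½+ε]²D = prime-in-range D disc Dε<D
        h≤p = Hmin≤p disc p-prime p≢2 [D/p]≡1 D≤4p² hmin
    in ℚ.≤-trans (ℕtoℚ-mono-≤ (ℕ.*-mono-≤ h≤p h≤p)) p²≤[½+ε]²D
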